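{- For every vector $\vec k$ of positive integers, the filling algorithm $\eta_*$ defines a bijection from $\mathcal{D}_{\vec k}$ onto $\mathcal{NF}_{\vec k}:=\{\eta_*(\pi):\pi\in\mathcal{D}_{\vec k}\}$; equivalently, $\eta_*$ is injective on $\mathcal{D}_{\vec k}$.
   Context: Let $\vec{k}=(k_1,\dots,k_\ell)$, $N=|\vec k|+\ell$. A $\vec{k}$-Dyck path is a word $\pi=\pi_1\cdots\pi_N$ consisting of the letters $S^{k_1},\dots,S^{k_\ell}$, each exactly once and in this order from left to right, together with $|\vec k|$ letters $W$, such that the starting ranks $r_1=0$, $r_{i+1}=r_i+k_j$ if $\pi_i=S^{k_j}$, $r_{i+1}=r_i-1$ if $\pi_i=W$, are all nonnegative. $\mathcal{D}_{\vec k}$ is the set of $\vec k$-Dyck paths. Filling algorithm $\eta_*$: in a tableau of $\ell$ top-justified columns, column $i$ with $k_i+1$ cells, place $1,\dots,N$ successively: $1$ at the top of column 1; for $i\ge2$, if $\pi_i$ is an $S$-letter put $i$ at the top of the leftmost empty column, and if $\pi_i=W$ put $i$ immediately below the largest active entry (an entry is active if it is currently the bottom-most entry of its column $j$ and that column has fewer than $k_j+1$ entries). The resulting tableau is $\eta_*(\pi)$. -}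

module Defs where

open import Data.Nat using (ℕ; zero; suc; _+_; _≤_; _<?_; _≟_; _⊔_)
open import Data.Integer as ℤ using (ℤ; +_)
open import Data.List using (List; []; _∷_; length; map)
open import Data.Nat.ListAction using (sum)
open import Data.List.Relation.Unary.All using (All)
open import Data.Maybe using (Maybe; just; nothing)
open import Data.Product using (_×_; _,_; proj₂)
open import Relation.Nullary using (yes; no)
open import Relation.Binary.PropositionalEquality using (_≡_)

-- Letters of a k-Dyck path: S k stands for the letter S^k, and W for W.
data Letter : Set where
  S : ℕ → Letter
  W : Letter

sLetters : List Letter → List ℕ
sLetters []          = []
sLetters (S k ∷ w)   = k ∷ sLetters w
sLetters (W ∷ w)     = sLetters w

countW : List Letter → ℕ
countW []          = 0
countW (S _ ∷ w)   = countW w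
countW (W ∷ w)     = suc (countW w)

stepRank : ℤ → Letter → ℤ
stepRank r (S k) = r ℤ.+ (+ k)
stepRank r W     = r ℤ.- (+ 1)

ranks : ℤ → List Letter → List ℤ
ranks r []      = []
ranks r (x ∷ w) = r ∷ ranks (stepRank r x) w

IsDyck : List ℕ → List Letter → Set
IsDyck k π = (sLetters π ≡ k) × (countW π ≡ sum k)
           × All (λ r → + 0 ℤ.≤ r) (ranks (+ 0) π)

-- Filling algorithm η_*.
-- A column is a pair (k_j , entries from top to bottom); it has k_j + 1 cells.

Col : Set
Col = ℕ × List ℕ

emptyTab : List ℕ → List Col
emptyTab = map (λ k → (k , []))

lastM : List ℕ → Maybe ℕ
lastM []          = nothing
lastM (x ∷ [])    = just x
lastM (x ∷ y ∷ l) = lastM (y ∷ l)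

activeBottom : Col → Maybe ℕ
activeBottom (k , []) = nothing
activeBottom (k , e@(_ ∷ _)) with length e <? suc k
... | yes _ = lastM e
... | no _  = nothing

maxM : Maybe ℕ → Maybe ℕ → Maybe ℕ
maxM nothing  m        = m
maxM (just a) nothing  = just a
maxM (just a) (just b) = just (a ⊔ b)

largestActive : List Col → Maybe ℕ
largestActive []      = nothing
largestActive (c ∷ T) = maxM (activeBottom c) (largestActive T)

putTopLeftmostEmpty : ℕ → List Col → List Col
putTopLeftmostEmpty i []                = []
putTopLeftmostEmpty i ((k , []) ∷ T)    = (k , i ∷ []) ∷ T
putTopLeftmostEmpty i ((k , e@(_ ∷ _)) ∷ T) = (k , e) ∷ putTopLeftmostEmpty i T

appendBelow : ℕ → ℕ → List Col → List Col
appendBelow b i [] = []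
appendBelow b i ((k , e) ∷ T) with activeBottom (k , e)
... | nothing = (k , e) ∷ appendBelow b i T
... | just x with x ≟ b
...   | yes _ = (k , e Data.List.++ (i ∷ [])) ∷ T
...   | no _  = (k , e) ∷ appendBelow b i T

putTopFirst : ℕ → List Col → List Col
putTopFirst i []             = []
putTopFirst i ((k , e) ∷ T)  = (k , i ∷ e) ∷ T

place : ℕ → Letter → List Col → List Col
place 1 _ T = putTopFirst 1 T
place i (S _) T = putTopLeftmostEmpty i T
place i W T with largestActive T
... | just b  = appendBelow b i T
... | nothing = T   -- never happens for k-Dyck paths

fillFrom : ℕ → List Letter → List Col → List Col
fillFrom i []      T = T
fillFrom i (x ∷ w) T = fillFrom (suc i) w (place i x T)

eta : List ℕ → List Letter → List (List ℕ)
eta k π = map proj₂ (fillFrom 1 π (emptyTab k))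

-- An S-letter at position i ≥ 2 writes i at the top of the leftmost empty
-- column, so columns are opened from left to right, while a W-letter only
-- extends an already opened column downwards.  Hence the first row of η_*(π)
-- lists the positions of the S-letters of π in increasing order.  A word is
-- determined by these positions together with its sequence of S-letters and
-- its number of W's, which are fixed by the vector k.
module Submission where

open import Defs
open import Data.Nat using (ℕ; zero; suc; _≤_; _≟_)
open import Data.Nat.Properties using (suc-injective; n≮n; ≤-refl; <⇒≤)
open import Data.List using (List; []; _∷_; [_]; _++_; _∷ʳ_; map; head; mapMaybe)
open import Data.List.Properties using (∷-injective; map-++; mapMaybe-++; ++-identityʳ; ∷ʳ-++)
open import Data.List.Relation.Unary.All as All using (All; []; _∷_)
open import Data.List.Relation.Unary.All.Properties using (++⁺)
open import Data.Maybe using (just; nothing)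
open import Data.Product using (_,_; proj₂)
open import Data.Empty using (⊥-elim)
open import Function using (_∘_)
open import Relation.Nullary using (¬_; yes; no)
open import Relation.Binary.PropositionalEquality using (_≡_; _≢_; refl; sym; trans; cong; subst; module ≡-Reasoning)

open ≡-Reasoning

firstRow : List Col → List ℕ
firstRow T = mapMaybe head (map proj₂ T)

firstRow-++ : ∀ T U → firstRow (T ++ U) ≡ firstRow T ++ firstRow U
firstRow-++ T U = trans (cong (mapMaybe head) (map-++ proj₂ T U))
                         (mapMaybe-++ head (map proj₂ T) (map proj₂ U))

data Filled : Col → Set where
  filled : ∀ {k i e} → Filled (k , i ∷ e)

putTopLeftmostEmpty-after-filled : ∀ {i k F} E → All Filled F →
  putTopLeftmostEmpty i (F ++ (k , []) ∷ E) ≡ F ++ (k , i ∷ []) ∷ E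
putTopLeftmostEmpty-after-filled E []                = refl
putTopLeftmostEmpty-after-filled E (filled ∷ filledF) =
  cong (_ ∷_) (putTopLeftmostEmpty-after-filled E filledF)

appendBelow-emptyTab : ∀ {b i} ks → appendBelow b i (emptyTab ks) ≡ emptyTab ks
appendBelow-emptyTab []       = refl
appendBelow-emptyTab (k ∷ ks) = cong (_ ∷_) (appendBelow-emptyTab ks)

appendBelow-++ : ∀ {b i} F E → appendBelow b i E ≡ E →
  appendBelow b i (F ++ E) ≡ appendBelow b i F ++ E
appendBelow-++ [] E fixE = fixE
appendBelow-++ {b} ((k , e) ∷ F) E fixE with activeBottom (k , e)
... | nothing = cong ((k , e) ∷_) (appendBelow-++ F E fixE)
... | just x with x ≟ b
...   | yes _ = refl
...   | no _  = cong ((k , e) ∷_) (appendBelow-++ F E fixE)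

firstRow-appendBelow : ∀ {b i} T → firstRow (appendBelow b i T) ≡ firstRow T
firstRow-appendBelow []              = refl
firstRow-appendBelow ((k , []) ∷ T) = firstRow-appendBelow T
firstRow-appendBelow {b} ((k , a ∷ e) ∷ T) with activeBottom (k , a ∷ e)
... | nothing = cong (a ∷_) (firstRow-appendBelow T)
... | just x with x ≟ b
...   | yes _ = refl
...   | no _  = cong (a ∷_) (firstRow-appendBelow T)

appendBelow-Filled : ∀ {b i F} → All Filled F → All Filled (appendBelow b i F)
appendBelow-Filled [] = []
appendBelow-Filled {b} {F = (k , a ∷ e) ∷ F} (filled ∷ filledF) with activeBottom (k , a ∷ e)
... | nothing = filled ∷ appendBelow-Filled filledF
... | just x with x ≟ b
...   | yes _ = filled ∷ filledF
...   | no _  = filled ∷ appendBelow-Filled filledF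

sPositions : ℕ → List Letter → List ℕ
sPositions n []        = []
sPositions n (S _ ∷ w) = n ∷ sPositions (suc n) w
sPositions n (W ∷ w)   = sPositions (suc n) w

sPositions-≥ : ∀ n w → All (n ≤_) (sPositions n w)
sPositions-≥ n []        = []
sPositions-≥ n (S _ ∷ w) = ≤-refl ∷ All.map <⇒≤ (sPositions-≥ (suc n) w)
sPositions-≥ n (W ∷ w)   = All.map <⇒≤ (sPositions-≥ (suc n) w)

n∷xs≢sPositions-1+n : ∀ {n xs} w → n ∷ xs ≢ sPositions (suc n) w
n∷xs≢sPositions-1+n {n} w eq =
  n≮n n (All.head (subst (All (suc n ≤_)) (sym eq) (sPositions-≥ (suc n) w)))

sPositions-injective : ∀ {n} π σ → sLetters π ≡ sLetters σ → countW π ≡ countW σ →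
  sPositions n π ≡ sPositions n σ → π ≡ σ
sPositions-injective []        []        _  _  _  = refl
sPositions-injective []        (S _ ∷ σ) () _  _
sPositions-injective []        (W ∷ σ)   _  () _
sPositions-injective (S _ ∷ π) []        () _  _
sPositions-injective (W ∷ π)   []        _  () _
sPositions-injective (S a ∷ π) (S b ∷ σ) sl cw ps with ∷-injective sl | ∷-injective ps
... | refl , sl′ | _ , ps′ = cong (S a ∷_) (sPositions-injective π σ sl′ cw ps′)
sPositions-injective (W ∷ π)   (W ∷ σ)   sl cw ps =
  cong (W ∷_) (sPositions-injective π σ sl (suc-injective cw) ps)
sPositions-injective (S _ ∷ π) (W ∷ σ)   _  _  ps = ⊥-elim (n∷xs≢sPositions-1+n σ ps)
sPositions-injective (W ∷ π)   (S _ ∷ σ) _  _  ps = ⊥-elim (n∷xs≢sPositions-1+n π (sym ps))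

firstRow-fillFrom : ∀ n w F → All Filled F →
  firstRow (fillFrom (suc (suc n)) w (F ++ emptyTab (sLetters w)))
    ≡ firstRow F ++ sPositions (suc (suc n)) w
firstRow-fillFrom n [] F _ = begin
  firstRow (F ++ [])  ≡⟨ cong firstRow (++-identityʳ F) ⟩
  firstRow F          ≡⟨ ++-identityʳ (firstRow F) ⟨
  firstRow F ++ []    ∎
firstRow-fillFrom n (S a ∷ w) F filledF = begin
  firstRow (fill (putTopLeftmostEmpty i (F ++ (a , []) ∷ E)))
    ≡⟨ cong (firstRow ∘ fill) (putTopLeftmostEmpty-after-filled E filledF) ⟩
  firstRow (fill (F ++ column ∷ E))
    ≡⟨ cong (firstRow ∘ fill) (∷ʳ-++ F column E) ⟨
  firstRow (fill (F ∷ʳ column ++ E))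
    ≡⟨ firstRow-fillFrom (suc n) w (F ∷ʳ column) (++⁺ filledF (filled ∷ [])) ⟩
  firstRow (F ∷ʳ column) ++ sPositions (suc i) w
    ≡⟨ cong (_++ sPositions (suc i) w) (firstRow-++ F [ column ]) ⟩
  (firstRow F ∷ʳ i) ++ sPositions (suc i) w
    ≡⟨ ∷ʳ-++ (firstRow F) i (sPositions (suc i) w) ⟩
  firstRow F ++ i ∷ sPositions (suc i) w
    ∎
  where
  i = suc (suc n)
  E = emptyTab (sLetters w)
  column = (a , i ∷ [])
  fill = fillFrom (suc i) w
firstRow-fillFrom n (W ∷ w) F filledF with largestActive (F ++ emptyTab (sLetters w))
... | nothing = firstRow-fillFrom (suc n) w F filledF
... | just b  = begin
  firstRow (fill (appendBelow b i (F ++ E)))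
    ≡⟨ cong (firstRow ∘ fill) (appendBelow-++ F E (appendBelow-emptyTab (sLetters w))) ⟩
  firstRow (fill (appendBelow b i F ++ E))
    ≡⟨ firstRow-fillFrom (suc n) w (appendBelow b i F) (appendBelow-Filled filledF) ⟩
  firstRow (appendBelow b i F) ++ sPositions (suc i) w
    ≡⟨ cong (_++ sPositions (suc i) w) (firstRow-appendBelow F) ⟩
  firstRow F ++ sPositions (suc i) w
    ∎
  where
  i = suc (suc n)
  E = emptyTab (sLetters w)
  fill = fillFrom (suc i) w

¬IsDyck-W∷ : ∀ {k π} → ¬ IsDyck k (W ∷ π)
¬IsDyck-W∷ {π = []}    (refl , () , _)
¬IsDyck-W∷ {π = _ ∷ _} (_ , _ , _ ∷ () ∷ _)

firstRow-eta : ∀ {k} π → IsDyck k π → mapMaybe head (eta k π) ≡ sPositions 1 π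
firstRow-eta []        (refl , _) = refl
firstRow-eta (W ∷ π)   dyck       = ⊥-elim (¬IsDyck-W∷ dyck)
firstRow-eta (S a ∷ π) (refl , _) = firstRow-fillFrom zero π [ (a , 1 ∷ []) ] (filled ∷ [])

proposition3p11 : (k : List ℕ) → All (λ x → 1 ≤ x) k →
    (π σ : List Letter) → IsDyck k π → IsDyck k σ →
    eta k π ≡ eta k σ → π ≡ σ
proposition3p11 k _ π σ dπ@(sπ , wπ , _) dσ@(sσ , wσ , _) eq =
  sPositions-injective π σ (trans sπ (sym sσ)) (trans wπ (sym wσ)) (begin
    sPositions 1 π          ≡⟨ firstRow-eta π dπ ⟨
    mapMaybe head (eta k π) ≡⟨ cong (mapMaybe head) eq ⟩
    mapMaybe head (eta k σ) ≡⟨ firstRow-eta σ dσ ⟩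
    sPositions 1 σ          ∎)
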